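{- For non-negative integers $n$ and $\ell$, and real number $\alpha$, $$\widetilde{D}_{(\alpha)}(n+\ell;x)=\sum_{j=0}^{\ell}\sum_{k=0}^n\widetilde{W}_{(\alpha)}(\ell,j)\binom{n}{k}(j\alpha)^{n-k}\widetilde{D}_{(\alpha)}(k;x)\,x^j$$ and $$\widetilde{D}_{(\alpha)}(n+\ell)=\sum_{j=0}^{\ell}\sum_{k=0}^n\widetilde{W}_{(\alpha)}(\ell,j)\binom{n}{k}(j\alpha)^{n-k}\widetilde{D}_{(\alpha)}(k).$$
   Context: For real $\alpha$, the translated Whitney numbers of the second kind $\widetilde{W}_{(\alpha)}(n,k)$ are defined as $W_{\alpha,0}(n,k)$, where the $r$-Whitney numbers of the second kind $W_{m,r}(n,k)$ are given by $W_{m,r}(0,0)=1$, $W_{m,r}(n,k)=0$ for $k<0$ or $k>n$, and $W_{m,r}(n,k)=W_{m,r}(n-1,k-1)+(mk+r)W_{m,r}(n-1,k)$ for $n\ge1$ (for $\alpha\neq0$ equivalently $t^n=\sum_{k=0}^n\widetilde{W}_{(\alpha)}(n,k)\prod_{i=0}^{k-1}(t-i\alpha)$). The translated Dowling polynomials are $\widetilde{D}_{(\alpha)}(n;x)=\sum_{k=0}^n\widetilde{W}_{(\alpha)}(n,k)x^k$ and the translated Dowling numbers are $\widetilde{D}_{(\alpha)}(n)=\widetilde D_{(\alpha)}(n;1)$. The convention $0^0=1$ is used. -}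

module Defs where

open import Level using (Level)
open import Algebra.Bundles using (CommutativeRing)
open import Data.Nat using (ℕ; zero; suc)
import Data.Nat as ℕ
open import Data.Nat.Combinatorics using (_C_)

-- All definitions are over an arbitrary commutative ring R (in the paper R = ℝ).
module Whitney {c ℓ : Level} (R : CommutativeRing c ℓ) where
  open CommutativeRing R hiding (zero)

  fromℕ : ℕ → Carrier
  fromℕ zero = 0#
  fromℕ (suc k) = 1# + fromℕ k

  -- powers, with a ^ 0 = 1 (so 0 ^ 0 = 1)
  _^_ : Carrier → ℕ → Carrier
  a ^ zero = 1#
  a ^ suc k = a * (a ^ k)

  sumTo : ℕ → (ℕ → Carrier) → Carrier
  sumTo zero f = f zero
  sumTo (suc n) f = sumTo n f + f (suc n)

  rWhitney : Carrier → Carrier → ℕ → ℕ → Carrier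
  rWhitney m r zero zero = 1#
  rWhitney m r zero (suc k) = 0#
  rWhitney m r (suc n) zero = (m * fromℕ zero + r) * rWhitney m r n zero
  rWhitney m r (suc n) (suc k) =
    rWhitney m r n k + (m * fromℕ (suc k) + r) * rWhitney m r n (suc k)

  tW : Carrier → ℕ → ℕ → Carrier
  tW α = rWhitney α 0#

  tD : Carrier → ℕ → Carrier → Carrier
  tD α n x = sumTo n (λ k → tW α n k * (x ^ k))

  tDnum : Carrier → ℕ → Carrier
  tDnum α n = tD α n 1#

  binom : ℕ → ℕ → Carrier
  binom n k = fromℕ (n C k)

module Submission where

-- Fix α and x and let D_r(n) be the r-shifted Dowling polynomial,
-- defined by  D_r(0) = 1,  D_r(n+1) = r·D_r(n) + x·D_{α+r}(n).
-- The argument has three steps.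
--  (1) Binomial translation: D_{r+s}(n) = Σ_k C(n,k) r^(n-k) D_s(k).  This is
--      proved by induction on n through the Pascal recurrence of the
--      "binomial transform" f ↦ Σ_k C(n,k) r^(n-k) f(k).
--  (2) Whitney expansion: D̃(n+l;x) = Σ_j W̃(l,j) x^j D_{jα}(n).  One unit moves from l to n using the Whitney
--      recurrence W̃(l+1,j+1) = W̃(l,j) + (j+1)α·W̃(l,j+1) together with the
--      recurrence of D_r.  For l = 0 it gives D_0(k) = D̃(k;x).
--  (3) Substituting (1) with r = jα, s = 0 into (2) gives the first identity of
--      the corollary.

open import Defs
open import Level using (Level)
open import Algebra.Bundles using (CommutativeRing)
open import Data.Nat using (ℕ; zero; suc; _∸_)
import Data.Nat as ℕ
open import Data.Product using (_×_; _,_)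
open import Data.Nat.Combinatorics using (_C_; nCk+nC[k+1]≡[n+1]C[k+1]; k>n⇒nCk≡0)
import Data.Nat.Properties as ℕₚ
import Relation.Binary.PropositionalEquality as P

module DowlingConvolution {c ℓ : Level} (R : CommutativeRing c ℓ) where
  open CommutativeRing R hiding (zero)
  open Whitney R
  open import Algebra.Solver.Ring.NaturalCoefficients.Default commutativeSemiring
    using (solve; _:=_; _:+_; _:*_)
  open import Relation.Binary.Reasoning.Setoid setoid

  sumTo-congᵇ : ∀ n {f g : ℕ → Carrier} → (∀ k → k ℕ.≤ n → f k ≈ g k) →
                sumTo n f ≈ sumTo n g
  sumTo-congᵇ zero    f≈g = f≈g 0 ℕ.z≤n
  sumTo-congᵇ (suc n) f≈g =
    +-cong (sumTo-congᵇ n (λ k k≤n → f≈g k (ℕₚ.m≤n⇒m≤1+n k≤n))) (f≈g (suc n) ℕₚ.≤-refl)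

  sumTo-cong : ∀ n {f g : ℕ → Carrier} → (∀ k → f k ≈ g k) → sumTo n f ≈ sumTo n g
  sumTo-cong n f≈g = sumTo-congᵇ n (λ k _ → f≈g k)

  sumTo-+ : ∀ n (f g : ℕ → Carrier) →
            sumTo n (λ k → f k + g k) ≈ sumTo n f + sumTo n g
  sumTo-+ zero    f g = refl
  sumTo-+ (suc n) f g = trans (+-cong (sumTo-+ n f g) refl)
    (solve 4 (λ a b c d → ((a :+ b) :+ (c :+ d)) := ((a :+ c) :+ (b :+ d))) refl _ _ _ _)

  sumTo-*ˡ : ∀ n (a : Carrier) (f : ℕ → Carrier) →
             a * sumTo n f ≈ sumTo n (λ k → a * f k)
  sumTo-*ˡ zero    a f = refl
  sumTo-*ˡ (suc n) a f = trans (distribˡ a _ _) (+-cong (sumTo-*ˡ n a f) refl)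

  sumTo-peel : ∀ n (f : ℕ → Carrier) →
               sumTo (suc n) f ≈ f 0 + sumTo n (λ k → f (suc k))
  sumTo-peel zero    f = refl
  sumTo-peel (suc n) f = trans (+-cong (sumTo-peel n f) refl) (+-assoc _ _ _)

  sumTo-reindex : ∀ n (f : ℕ → Carrier) → f (suc n) ≈ 0# →
                  sumTo n f ≈ f 0 + sumTo n (λ k → f (suc k))
  sumTo-reindex n f fn+1≈0 = begin
    sumTo n f                  ≈⟨ sym (+-identityʳ _) ⟩
    sumTo n f + 0#             ≈⟨ +-cong refl (sym fn+1≈0) ⟩
    sumTo (suc n) f            ≈⟨ sumTo-peel n f ⟩
    f 0 + sumTo n (λ k → f (suc k)) ∎

  fromℕ-+ : ∀ a b → fromℕ (a ℕ.+ b) ≈ fromℕ a + fromℕ b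
  fromℕ-+ zero    b = sym (+-identityˡ _)
  fromℕ-+ (suc a) b = trans (+-cong refl (fromℕ-+ a b)) (sym (+-assoc _ _ _))

  binom-pascal : ∀ n k → binom (suc n) (suc k) ≈ binom n k + binom n (suc k)
  binom-pascal n k =
    trans (reflexive (P.cong fromℕ (P.sym (nCk+nC[k+1]≡[n+1]C[k+1] n k))))
          (fromℕ-+ (n C k) (n C suc k))

  binom-beyond : ∀ n → binom n (suc n) ≈ 0#
  binom-beyond n = reflexive (P.cong fromℕ (k>n⇒nCk≡0 (ℕₚ.n<1+n n)))

  1^ : ∀ j → 1# ^ j ≈ 1#
  1^ zero    = refl
  1^ (suc j) = trans (*-cong refl (1^ j)) (*-identityʳ _)

  zero-product : ∀ {a} b c → a ≈ 0# → a * b * c ≈ 0#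
  zero-product b c a≈0 = trans (*-cong (trans (*-cong a≈0 refl) (zeroˡ b)) refl) (zeroˡ c)

  binTransform : Carrier → ℕ → (ℕ → Carrier) → Carrier
  binTransform r n f = sumTo n (λ k → binom n k * (r ^ (n ∸ k)) * f k)

  binTransform-cong : ∀ r n {f g : ℕ → Carrier} → (∀ k → f k ≈ g k) →
                      binTransform r n f ≈ binTransform r n g
  binTransform-cong r n f≈g = sumTo-cong n (λ k → *-cong refl (f≈g k))

  binTransform-linear : ∀ r n a b (f g : ℕ → Carrier) →
    binTransform r n (λ k → a * f k + b * g k) ≈
    a * binTransform r n f + b * binTransform r n g
  binTransform-linear r n a b f g = begin
    binTransform r n (λ k → a * f k + b * g k)
      ≈⟨ sumTo-cong n (λ k → distribute (binom n k * (r ^ (n ∸ k))) (f k) (g k)) ⟩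
    sumTo n (λ k → a * (binom n k * (r ^ (n ∸ k)) * f k) + b * (binom n k * (r ^ (n ∸ k)) * g k))
      ≈⟨ sumTo-+ n _ _ ⟩
    _ ≈⟨ +-cong (sym (sumTo-*ˡ n a _)) (sym (sumTo-*ˡ n b _)) ⟩
    a * binTransform r n f + b * binTransform r n g ∎
    where
    distribute : ∀ p u v → p * (a * u + b * v) ≈ a * (p * u) + b * (p * v)
    distribute = solve 5 (λ a b p u v → (p :* ((a :* u) :+ (b :* v))) :=
                                        ((a :* (p :* u)) :+ (b :* (p :* v)))) refl a b

  -- Both sides split into the k-th and (k+1)-st Pascal halves:
  --   A = Σ_k C(n,k) r^(n-k) f(k+1)  and  B = Σ_k C(n,k+1) r^(n-k) f(k+1).
  binTransform-step : ∀ r n (f : ℕ → Carrier) →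
    binTransform r (suc n) f ≈ r * binTransform r n f + binTransform r n (λ k → f (suc k))
  binTransform-step r n f = begin
    binTransform r (suc n) f            ≈⟨ lhs-split ⟩
    g 0 + (sumTo n A + sumTo n B)       ≈⟨ solve 3 (λ a b c → (a :+ (b :+ c)) := ((a :+ c) :+ b))
                                                   refl (g 0) (sumTo n A) (sumTo n B) ⟩
    (g 0 + sumTo n B) + sumTo n A       ≈⟨ +-cong (sym r*-split) refl ⟩
    r * binTransform r n f + binTransform r n (λ k → f (suc k)) ∎
    where
    g A B : ℕ → Carrier
    g k = binom (suc n) k * (r ^ (suc n ∸ k)) * f k
    A k = binom n k * (r ^ (n ∸ k)) * f (suc k)
    B k = binom n (suc k) * (r ^ (n ∸ k)) * f (suc k)

    lhs-split : binTransform r (suc n) f ≈ g 0 + (sumTo n A + sumTo n B)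
    lhs-split = trans (sumTo-peel n g) (+-cong refl (trans (sumTo-cong n pascal) (sumTo-+ n A B)))
      where
      pascal : ∀ k → g (suc k) ≈ A k + B k
      pascal k = trans (*-cong (*-cong (binom-pascal n k) refl) refl)
        (solve 4 (λ a b p q → (((a :+ b) :* p) :* q) := (((a :* p) :* q) :+ ((b :* p) :* q)))
               refl _ _ _ _)

    -- r·Bᵣ(n; f) has the same k = 0 term as Bᵣ(n+1; f); its tail is B,
    -- because r·r^(n-k) = r^(n+1-(k+1)) and the top term C(n,n+1) vanishes.
    r*-split : r * binTransform r n f ≈ g 0 + sumTo n B
    r*-split = begin
      r * binTransform r n f   ≈⟨ sumTo-*ˡ n r _ ⟩
      sumTo n (λ k → r * (binom n k * (r ^ (n ∸ k)) * f k))  ≈⟨ sumTo-congᵇ n absorb ⟩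
      sumTo n u                ≈⟨ sumTo-reindex n u (zero-product _ _ (binom-beyond n)) ⟩
      g 0 + sumTo n B          ∎
      where
      u : ℕ → Carrier
      u k = binom n k * (r ^ (suc n ∸ k)) * f k
      absorb : ∀ k → k ℕ.≤ n → r * (binom n k * (r ^ (n ∸ k)) * f k) ≈ u k
      absorb k k≤n = trans
        (solve 4 (λ r b p q → (r :* ((b :* p) :* q)) := ((b :* (r :* p)) :* q))
               refl r (binom n k) (r ^ (n ∸ k)) (f k))
        (*-cong (*-cong refl (reflexive (P.cong (r ^_) (P.sym (ℕₚ.+-∸-assoc 1 k≤n))))) refl)

  module Dowling (α x : Carrier) where

    rDowling : Carrier → ℕ → Carrier
    rDowling r zero    = 1#
    rDowling r (suc n) = r * rDowling r n + x * rDowling (α + r) n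

    rDowling-cong : ∀ n {r s} → r ≈ s → rDowling r n ≈ rDowling s n
    rDowling-cong zero    _   = refl
    rDowling-cong (suc n) r≈s =
      +-cong (*-cong r≈s (rDowling-cong n r≈s))
             (*-cong refl (rDowling-cong n (+-cong refl r≈s)))

    rDowling-translate : ∀ n r s → rDowling (r + s) n ≈ binTransform r n (λ k → rDowling s k)
    rDowling-translate zero r s =
      sym (trans (*-identityʳ _) (trans (*-identityʳ _) (+-identityʳ _)))
    rDowling-translate (suc n) r s = begin
      (r + s) * D (r + s) n + x * D (α + (r + s)) n
        ≈⟨ solve 5 (λ r s h x h' → (((r :+ s) :* h) :+ (x :* h')) :=
                                   ((r :* h) :+ ((s :* h) :+ (x :* h')))) refl r s _ x _ ⟩
      r * D (r + s) n + (s * D (r + s) n + x * D (α + (r + s)) n)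
        ≈⟨ +-cong (*-cong refl (IH s)) (+-cong (*-cong refl (IH s)) (*-cong refl shifted)) ⟩
      r * Bᵣ (D s) + (s * Bᵣ (D s) + x * Bᵣ (D (α + s)))
        ≈⟨ +-cong refl (sym (binTransform-linear r n s x (D s) (D (α + s)))) ⟩
      r * Bᵣ (D s) + Bᵣ (λ k → D s (suc k))
        ≈⟨ sym (binTransform-step r n (D s)) ⟩
      binTransform r (suc n) (D s) ∎
      where
      D : Carrier → ℕ → Carrier
      D = rDowling
      Bᵣ : (ℕ → Carrier) → Carrier
      Bᵣ = binTransform r n
      IH : ∀ s → D (r + s) n ≈ Bᵣ (D s)
      IH s = rDowling-translate n r s
      shifted : D (α + (r + s)) n ≈ Bᵣ (D (α + s))
      shifted = trans (rDowling-cong n (solve 3 (λ a r s → (a :+ (r :+ s)) := (r :+ (a :+ s)))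
                                                refl α r s))
                      (IH (α + s))

    W : ℕ → ℕ → Carrier
    W = tW α

    W-above : ∀ l k → l ℕ.< k → W l k ≈ 0#
    W-above zero    (suc k) _ = refl
    W-above (suc l) (suc k) (ℕ.s≤s l<k) =
      trans (+-cong (W-above l k l<k) (*-cong refl (W-above l (suc k) (ℕₚ.m<n⇒m<1+n l<k))))
            (trans (+-identityˡ _) (zeroʳ _))

    -- W̃(l+1,0) = 0, since the translation parameter r is 0.
    W-suc-zero : ∀ l → W (suc l) 0 ≈ 0#
    W-suc-zero l = trans (*-cong (trans (+-identityʳ _) (zeroʳ α)) refl) (zeroˡ _)

    term : ℕ → ℕ → ℕ → Carrier
    term l n j = W l j * (x ^ j) * rDowling (fromℕ j * α) n

    weighted raised : ℕ → ℕ → ℕ → Carrier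
    weighted l n j = W l j * (x ^ j) * (fromℕ j * α * rDowling (fromℕ j * α) n)
    raised   l n j = W l j * (x ^ j) * (x * rDowling (α + fromℕ j * α) n)

    term-split-level : ∀ l n j → term (suc l) n (suc j) ≈ raised l n j + weighted l n (suc j)
    term-split-level l n j =
      trans (*-cong (*-cong (+-cong refl (*-cong (+-identityʳ _) refl)) refl) refl)
      (trans (solve 7 (λ w₀ w₁ e g a h x →
                (((w₀ :+ ((a :* g) :* w₁)) :* (x :* e)) :* h) :=
                (((w₀ :* e) :* (x :* h)) :+ ((w₁ :* (x :* e)) :* ((g :* a) :* h))))
                refl (W l j) (W l (suc j)) (x ^ j) (1# + fromℕ j) α
                (rDowling ((1# + fromℕ j) * α) n) x)
             (+-cong (*-cong refl (*-cong refl (rDowling-cong n unfold))) refl))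
      where
      unfold : (1# + fromℕ j) * α ≈ α + fromℕ j * α
      unfold = trans (distribʳ α 1# (fromℕ j)) (+-cong (*-identityˡ α) refl)

    term-split-degree : ∀ l n j → term l (suc n) j ≈ weighted l n j + raised l n j
    term-split-degree l n j = distribˡ (W l j * (x ^ j)) _ _

    -- Σ_j weighted(j) may be re-indexed by j ↦ j+1: both end terms vanish.
    weighted-reindex : ∀ l n →
      sumTo l (weighted l n) ≈ sumTo l (λ j → weighted l n (suc j))
    weighted-reindex l n =
      trans (sumTo-reindex l (weighted l n) (zero-product _ _ (W-above l (suc l) (ℕₚ.n<1+n l))))
            (trans (+-cong first-vanishes refl) (+-identityˡ _))
      where
      first-vanishes : weighted l n 0 ≈ 0#
      first-vanishes = trans (*-cong refl (trans (*-cong (zeroˡ α) refl) (zeroˡ _))) (zeroʳ _)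

    level-to-degree : ∀ l n → sumTo (suc l) (term (suc l) n) ≈ sumTo l (term l (suc n))
    level-to-degree l n = begin
      sumTo (suc l) (term (suc l) n)
        ≈⟨ sumTo-peel l _ ⟩
      term (suc l) n 0 + sumTo l (λ j → term (suc l) n (suc j))
        ≈⟨ +-cong (zero-product _ _ (W-suc-zero l)) (sumTo-cong l (term-split-level l n)) ⟩
      0# + sumTo l (λ j → raised l n j + weighted l n (suc j))
        ≈⟨ trans (+-identityˡ _) (sumTo-+ l _ _) ⟩
      sumTo l (raised l n) + sumTo l (λ j → weighted l n (suc j))
        ≈⟨ trans (+-comm _ _) (+-cong (sym (weighted-reindex l n)) refl) ⟩
      sumTo l (weighted l n) + sumTo l (raised l n)
        ≈⟨ sym (trans (sumTo-cong l (term-split-degree l n)) (sumTo-+ l _ _)) ⟩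
      sumTo l (term l (suc n)) ∎

    whitney-expansion : ∀ n l → tD α (n ℕ.+ l) x ≈ sumTo l (term l n)
    whitney-expansion zero    l = sumTo-cong l (λ _ → sym (*-identityʳ _))
    whitney-expansion (suc n) l =
      trans (reflexive (P.cong (λ m → tD α m x) (P.sym (ℕₚ.+-suc n l))))
            (trans (whitney-expansion n (suc l)) (level-to-degree l n))

    -- Level 0 of the expansion identifies D_0 with the translated Dowling polynomial.
    rDowling-zero : ∀ k → rDowling 0# k ≈ tD α k x
    rDowling-zero k = begin
      rDowling 0# k             ≈⟨ rDowling-cong k (sym (zeroˡ α)) ⟩
      rDowling (0# * α) k       ≈⟨ sym (trans (*-cong (*-identityˡ 1#) refl) (*-identityˡ _)) ⟩
      sumTo 0 (term 0 k)        ≈⟨ sym (whitney-expansion k 0) ⟩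
      tD α (k ℕ.+ 0) x          ≈⟨ reflexive (P.cong (λ m → tD α m x) (ℕₚ.+-identityʳ k)) ⟩
      tD α k x                  ∎

    -- Each term, expanded by binomial translation from shift 0 to shift jα.
    term-expand : ∀ l n j → term l n j ≈
      sumTo n (λ k → W l j * binom n k * ((fromℕ j * α) ^ (n ∸ k)) * tD α k x * (x ^ j))
    term-expand l n j = begin
      W l j * (x ^ j) * rDowling (fromℕ j * α) n
        ≈⟨ *-cong refl (rDowling-cong n (sym (+-identityʳ _))) ⟩
      W l j * (x ^ j) * rDowling (fromℕ j * α + 0#) n
        ≈⟨ *-cong refl (rDowling-translate n (fromℕ j * α) 0#) ⟩
      W l j * (x ^ j) * binTransform (fromℕ j * α) n (rDowling 0#)
        ≈⟨ *-cong refl (binTransform-cong _ n rDowling-zero) ⟩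
      W l j * (x ^ j) * binTransform (fromℕ j * α) n (λ k → tD α k x)
        ≈⟨ sumTo-*ˡ n _ _ ⟩
      _ ≈⟨ sumTo-cong n (λ k → solve 5 (λ w e b p d →
             ((w :* e) :* ((b :* p) :* d)) := ((((w :* b) :* p) :* d) :* e))
             refl (W l j) (x ^ j) (binom n k) ((fromℕ j * α) ^ (n ∸ k)) (tD α k x)) ⟩
      sumTo n (λ k → W l j * binom n k * ((fromℕ j * α) ^ (n ∸ k)) * tD α k x * (x ^ j)) ∎

    polynomial-identity : ∀ n l → tD α (n ℕ.+ l) x ≈ sumTo l (λ j → sumTo n (λ k →
      W l j * binom n k * ((fromℕ j * α) ^ (n ∸ k)) * tD α k x * (x ^ j)))
    polynomial-identity n l = trans (whitney-expansion n l) (sumTo-cong l (term-expand l n))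

  number-identity : ∀ α n l → tDnum α (n ℕ.+ l) ≈ sumTo l (λ j → sumTo n (λ k →
    tW α l j * binom n k * ((fromℕ j * α) ^ (n ∸ k)) * tDnum α k))
  number-identity α n l = trans (Dowling.polynomial-identity α 1# n l)
    (sumTo-cong l (λ j → sumTo-cong n (λ k → trans (*-cong refl (1^ j)) (*-identityʳ _))))

corollary5 : ∀ {c ℓ : Level} (R : CommutativeRing c ℓ) →
    let open CommutativeRing R in
    let open Whitney R in
    ∀ (α x : Carrier) (n l : ℕ) →
      (tD α (n ℕ.+ l) x ≈
        sumTo l (λ j → sumTo n (λ k →
          tW α l j * binom n k * ((fromℕ j * α) ^ (n ∸ k)) * tD α k x * (x ^ j))))
      ×
      (tDnum α (n ℕ.+ l) ≈
        sumTo l (λ j → sumTo n (λ k →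
          tW α l j * binom n k * ((fromℕ j * α) ^ (n ∸ k)) * tDnum α k)))
corollary5 R α x n l =
  DowlingConvolution.Dowling.polynomial-identity R α x n l ,
  DowlingConvolution.number-identity R α n l
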